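{- Let $m \geq 2$, let $n \geq 0$, and let $k_1,\ldots,k_m$ be positive integers with $k_1+\cdots+k_m = n+1$; write $\underline{k} = (k_1,\ldots,k_m)$. Then $$\binom{n+1}{k_1,\ldots,k_m}_q = \sum_{J \subseteq \{1,\ldots,m\},\ |J|>0} (-1)^{|J|-1} \frac{(q)_n}{(q)_{n-|J|+1}} \binom{n+1-|J|}{\underline{k} - \underline{e}_J}_q.$$
   Context: Let $q$ be a prime power (more generally a parameter $q\neq 1$). For $n \geq 1$ put $(q)_n = (1-q)(1-q^2)\cdots(1-q^n)$, and $(q)_0 = 1$. For non-negative integers $k_1,\ldots,k_m$ with $k_1+\cdots+k_m = N$, the $q$-multinomial coefficient is $\binom{N}{k_1,\ldots,k_m}_q = \frac{(q)_N}{(q)_{k_1}\cdots(q)_{k_m}}$; for an $m$-tuple $\underline{k}=(k_1,\ldots,k_m)$ we write $\binom{N}{\underline{k}}_q$ for it. For $J \subseteq \{1,\ldots,m\}$, $\underline{e}_J$ denotes the $m$-tuple $(e_1,\ldots,e_m)$ with $e_i = 1$ if $i \in J$ and $e_i = 0$ otherwise, and $\underline{k}-\underline{e}_J$ is componentwise subtraction. -}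

module Defs where

open import Data.Nat as ℕ using (ℕ; zero; suc; _∸_)
open import Data.Bool using (Bool; true; false; if_then_else_)
open import Data.List as List using (List; []; _∷_; _++_)
open import Data.Vec as Vec using (Vec; []; _∷_)
open import Data.Fin.Subset using (Subset; ∣_∣)
open import Data.Rational using (ℚ; 0ℚ; 1ℚ; _+_; _*_; _-_; -_; _÷_; ≢-nonZero)
open import Data.Rational.Properties using (_≟_)
open import Relation.Nullary using (yes; no)

_^_ : ℚ → ℕ → ℚ
x ^ zero  = 1ℚ
x ^ suc n = x * (x ^ n)

-- total division: x ⊘ y = x / y when y ≠ 0 (and 0 otherwise; never used
-- under the hypotheses of the statement, where all denominators are nonzero)
_⊘_ : ℚ → ℚ → ℚ
x ⊘ y with y ≟ 0ℚ
... | yes _   = 0ℚ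
... | no y≢0  = _÷_ x y {{≢-nonZero y≢0}}

qPoch : ℚ → ℕ → ℚ
qPoch q zero    = 1ℚ
qPoch q (suc n) = qPoch q n * (1ℚ - q ^ suc n)

qMultinomial : ℚ → (N : ℕ) → {m : ℕ} → Vec ℕ m → ℚ
qMultinomial q N ks = qPoch q N ⊘ Vec.foldr _ (λ k acc → qPoch q k * acc) 1ℚ ks

allSubsets : (m : ℕ) → List (Subset m)
allSubsets zero    = [] ∷ []
allSubsets (suc m) = List.map (true ∷_) (allSubsets m) ++ List.map (false ∷_) (allSubsets m)

nonemptySubsets : (m : ℕ) → List (Subset m)
nonemptySubsets m = List.filterᵇ (λ J → if ∣ J ∣ ℕ.≡ᵇ 0 then false else true) (allSubsets m)

minusE : {m : ℕ} → Vec ℕ m → Subset m → Vec ℕ m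
minusE ks J = Vec.zipWith (λ k b → if b then k ∸ 1 else k) ks J

sumℚ : List ℚ → ℚ
sumℚ = List.foldr _+_ 0ℚ

sign : ℕ → ℚ
sign n = (- 1ℚ) ^ n

module Submission where

-- Write P = ∏ᵢ (q)_{kᵢ} and xᵢ = 1 - q^{kᵢ}, and for a subset J
-- let x_J = ∏_{i∈J} xᵢ.  Since (q)_{kᵢ} = (q)_{kᵢ-1} xᵢ and every kᵢ ≥ 1,
--   P = (∏ᵢ (q)_{kᵢ - [i∈J]}) · x_J ,
-- so the J-th summand collapses to (-1)^{|J|-1} x_J (q)_n / P.  By
-- inclusion–exclusion (expanding ∏ᵢ (1 - xᵢ) over subsets),
--   Σ_{J ≠ ∅} (-1)^{|J|-1} x_J = 1 - ∏ᵢ (1 - xᵢ) = 1 - ∏ᵢ q^{kᵢ} = 1 - q^{n+1},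
-- and the right-hand side equals (1 - q^{n+1}) (q)_n / P = (q)_{n+1} / P, the
-- left-hand side.

open import Defs
open import Data.Nat using (ℕ; suc; _≤_; _∸_)
open import Data.Vec using (Vec; sum)
open import Data.Vec.Relation.Unary.All using (All)
open import Data.List using (map)
open import Data.Fin.Subset using (∣_∣)
open import Data.Rational using (ℚ; 0ℚ; 1ℚ; _*_; _-_)
open import Relation.Binary.PropositionalEquality using (_≡_; _≢_)

open import Data.Nat as ℕ using (zero; z≤n; s≤s)
import Data.Nat.Properties as ℕP
open import Data.Bool using (Bool; true; false; if_then_else_)
open import Data.List as List using (List; []; _∷_; _++_)
import Data.List.Properties as ListP
open import Data.Vec as Vec using ([]; _∷_)
open import Data.Vec.Relation.Unary.All as All using ([]; _∷_)
open import Data.Fin.Subset using (Subset)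
open import Data.Rational using (_+_; -_; 1/_; ≢-nonZero)
open import Data.Rational.Properties as ℚP using (_≟_)
open import Data.Rational.Solver using (module +-*-Solver)
open import Data.Empty using (⊥-elim)
open import Relation.Nullary using (yes; no)
open import Relation.Binary.PropositionalEquality
  using (refl; sym; trans; cong; cong₂; module ≡-Reasoning)
open +-*-Solver
open ≡-Reasoning

*-⊘-cancel : ∀ z y → y ≢ 0ℚ → (z * y) ⊘ y ≡ z
*-⊘-cancel z y y≢0 with y ≟ 0ℚ
... | yes y≡0 = ⊥-elim (y≢0 y≡0)
... | no  y≢0′ = begin
    z * y * 1/ y     ≡⟨ ℚP.*-assoc z y _ ⟩
    z * (y * 1/ y)   ≡⟨ cong (z *_) (ℚP.*-inverseʳ y) ⟩
    z * 1ℚ           ≡⟨ ℚP.*-identityʳ z ⟩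
    z                ∎
  where instance _ = ≢-nonZero y≢0′

⊘-*-cancel : ∀ x y → y ≢ 0ℚ → (x ⊘ y) * y ≡ x
⊘-*-cancel x y y≢0 with y ≟ 0ℚ
... | yes y≡0 = ⊥-elim (y≢0 y≡0)
... | no  y≢0′ = begin
    x * 1/ y * y     ≡⟨ ℚP.*-assoc x _ y ⟩
    x * (1/ y * y)   ≡⟨ cong (x *_) (ℚP.*-inverseˡ y) ⟩
    x * 1ℚ           ≡⟨ ℚP.*-identityʳ x ⟩
    x                ∎
  where instance _ = ≢-nonZero y≢0′

⊘-unique : ∀ x y z → y ≢ 0ℚ → z * y ≡ x → x ⊘ y ≡ z
⊘-unique x y z y≢0 zy≡x = trans (cong (_⊘ y) (sym zy≡x)) (*-⊘-cancel z y y≢0)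

*-≢0 : ∀ a b → a ≢ 0ℚ → b ≢ 0ℚ → a * b ≢ 0ℚ
*-≢0 a b a≢0 b≢0 ab≡0 = a≢0 (begin
  a                ≡⟨ sym (*-⊘-cancel a b b≢0) ⟩
  (a * b) ⊘ b      ≡⟨ cong (_⊘ b) (trans ab≡0 (sym (ℚP.*-zeroˡ b))) ⟩
  (0ℚ * b) ⊘ b     ≡⟨ *-⊘-cancel 0ℚ b b≢0 ⟩
  0ℚ               ∎)

-- A scalar factor of the numerator can be pulled out of a quotient
-- (this holds even for y = 0, where both sides vanish).
⊘-*-assoc : ∀ a b y → (a * b) ⊘ y ≡ a * (b ⊘ y)
⊘-*-assoc a b y with y ≟ 0ℚ
... | yes _ = sym (ℚP.*-zeroʳ a)
... | no  _ = ℚP.*-assoc a b _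

⊘-chain : ∀ x a b → a ≢ 0ℚ → (x ⊘ a) * (a ⊘ b) ≡ x ⊘ b
⊘-chain x a b a≢0 with a ≟ 0ℚ | b ≟ 0ℚ
... | yes a≡0 | _      = ⊥-elim (a≢0 a≡0)
... | no  a≢0′ | yes _ = ℚP.*-zeroʳ (x * 1/ a)
  where instance _ = ≢-nonZero a≢0′
... | no  a≢0′ | no  b≢0′ = begin
    x * ia * (a * ib)   ≡⟨ solve 4 (λ x ia a ib → x :* ia :* (a :* ib) := x :* (a :* ia) :* ib)
                                   refl x ia a ib ⟩
    x * (a * ia) * ib   ≡⟨ cong (λ t → x * t * ib) (ℚP.*-inverseʳ a) ⟩
    x * 1ℚ * ib         ≡⟨ cong (_* ib) (ℚP.*-identityʳ x) ⟩
    x * ib              ∎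
  where
  instance
    _ = ≢-nonZero a≢0′
    _ = ≢-nonZero b≢0′
  ia = 1/ a
  ib = 1/ b

⊘-factor : ∀ x b c → b * c ≢ 0ℚ → x ⊘ b ≡ c * (x ⊘ (b * c))
⊘-factor x b c bc≢0 = ⊘-unique x b _ b≢0 (begin
    c * w * b     ≡⟨ solve 3 (λ c w b → c :* w :* b := w :* (b :* c)) refl c w b ⟩
    w * (b * c)   ≡⟨ ⊘-*-cancel x (b * c) bc≢0 ⟩
    x             ∎)
  where
  w = x ⊘ (b * c)
  b≢0 : b ≢ 0ℚ
  b≢0 b≡0 = bc≢0 (trans (cong (_* c) b≡0) (ℚP.*-zeroˡ c))

sumℚ-++ : ∀ xs ys → sumℚ (xs ++ ys) ≡ sumℚ xs + sumℚ ys
sumℚ-++ []       ys = sym (ℚP.+-identityˡ _)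
sumℚ-++ (x ∷ xs) ys = trans (cong (x +_) (sumℚ-++ xs ys)) (sym (ℚP.+-assoc x _ _))

sumℚ-*ˡ : ∀ {A : Set} c (f : A → ℚ) xs →
          sumℚ (map (λ a → c * f a) xs) ≡ c * sumℚ (map f xs)
sumℚ-*ˡ c f []       = sym (ℚP.*-zeroʳ c)
sumℚ-*ˡ c f (x ∷ xs) =
  trans (cong (c * f x +_) (sumℚ-*ˡ c f xs)) (sym (ℚP.*-distribˡ-+ c (f x) _))

sumℚ-*ʳ : ∀ {A : Set} c (f : A → ℚ) xs →
          sumℚ (map (λ a → f a * c) xs) ≡ sumℚ (map f xs) * c
sumℚ-*ʳ c f []       = sym (ℚP.*-zeroˡ c)
sumℚ-*ʳ c f (x ∷ xs) =
  trans (cong (f x * c +_) (sumℚ-*ʳ c f xs)) (sym (ℚP.*-distribʳ-+ c (f x) _))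

sumℚ-filter : ∀ {A : Set} (p : A → Bool) (f : A → ℚ) xs →
  sumℚ (map f (List.filterᵇ p xs)) ≡ sumℚ (map (λ a → if p a then f a else 0ℚ) xs)
sumℚ-filter p f [] = refl
sumℚ-filter p f (x ∷ xs) with p x
... | true  = cong (f x +_) (sumℚ-filter p f xs)
... | false = trans (sumℚ-filter p f xs) (sym (ℚP.+-identityˡ _))

monomial : ∀ {m} → Vec ℚ m → Subset m → ℚ
monomial []       []          = 1ℚ
monomial (x ∷ xs) (true  ∷ J) = x * monomial xs J
monomial (x ∷ xs) (false ∷ J) = monomial xs J

complementProduct : ∀ {m} → Vec ℚ m → ℚ
complementProduct []       = 1ℚ
complementProduct (x ∷ xs) = (1ℚ - x) * complementProduct xs

weightedSum : (ℕ → ℚ) → ∀ {m} → Vec ℚ m → ℚ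
weightedSum w {m} xs = sumℚ (map (λ J → w ∣ J ∣ * monomial xs J) (allSubsets m))

weightedSum-∷ : ∀ w {m} x (xs : Vec ℚ m) →
  weightedSum w (x ∷ xs) ≡ x * weightedSum (λ j → w (suc j)) xs + weightedSum w xs
weightedSum-∷ w {m} x xs = begin
    sumℚ (map term (map (true ∷_) S ++ map (false ∷_) S))
  ≡⟨ cong sumℚ (ListP.map-++ term (map (true ∷_) S) _) ⟩
    sumℚ (map term (map (true ∷_) S) ++ map term (map (false ∷_) S))
  ≡⟨ sumℚ-++ (map term (map (true ∷_) S)) _ ⟩
    sumℚ (map term (map (true ∷_) S)) + sumℚ (map term (map (false ∷_) S))
  ≡⟨ cong₂ (λ a b → sumℚ a + sumℚ b) (sym (ListP.map-∘ S)) (sym (ListP.map-∘ S)) ⟩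
    sumℚ (map (λ J → w (suc ∣ J ∣) * (x * monomial xs J)) S) + weightedSum w xs
  ≡⟨ cong (λ t → sumℚ t + weightedSum w xs) (ListP.map-cong swap S) ⟩
    sumℚ (map (λ J → x * (w (suc ∣ J ∣) * monomial xs J)) S) + weightedSum w xs
  ≡⟨ cong (_+ weightedSum w xs) (sumℚ-*ˡ x (λ J → w (suc ∣ J ∣) * monomial xs J) S) ⟩
    x * weightedSum (λ j → w (suc j)) xs + weightedSum w xs
  ∎
  where
  S = allSubsets m
  term = λ J → w ∣ J ∣ * monomial (x ∷ xs) J
  swap : ∀ J → w (suc ∣ J ∣) * (x * monomial xs J) ≡ x * (w (suc ∣ J ∣) * monomial xs J)
  swap J = solve 3 (λ a b c → a :* (b :* c) := b :* (a :* c)) refl (w (suc ∣ J ∣)) x (monomial xs J)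

inclusionExclusion : ∀ {m} (xs : Vec ℚ m) → weightedSum sign xs ≡ complementProduct xs
inclusionExclusion []       = refl
inclusionExclusion {suc m} (x ∷ xs) = begin
    weightedSum sign (x ∷ xs)
  ≡⟨ weightedSum-∷ sign x xs ⟩
    x * weightedSum (λ j → sign (suc j)) xs + weightedSum sign xs
  ≡⟨ cong (λ t → x * t + weightedSum sign xs) shiftSign ⟩
    x * (- 1ℚ * weightedSum sign xs) + weightedSum sign xs
  ≡⟨ solve 2 (λ x s → x :* (con (- 1ℚ) :* s) :+ s := (con 1ℚ :- x) :* s) refl x _ ⟩
    (1ℚ - x) * weightedSum sign xs
  ≡⟨ cong ((1ℚ - x) *_) (inclusionExclusion xs) ⟩
    complementProduct (x ∷ xs)
  ∎
  where
  shiftSign : weightedSum (λ j → sign (suc j)) xs ≡ - 1ℚ * weightedSum sign xs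
  shiftSign = trans
    (cong sumℚ (ListP.map-cong (λ J → ℚP.*-assoc (- 1ℚ) (sign ∣ J ∣) (monomial xs J)) (allSubsets m)))
    (sumℚ-*ˡ (- 1ℚ) (λ J → sign ∣ J ∣ * monomial xs J) (allSubsets m))

nonemptySign : ℕ → ℚ
nonemptySign zero    = 0ℚ
nonemptySign (suc j) = sign j

inclusionExclusion⁺ : ∀ {m} (xs : Vec ℚ m) →
  weightedSum nonemptySign xs ≡ 1ℚ - complementProduct xs
inclusionExclusion⁺ []       = refl
inclusionExclusion⁺ (x ∷ xs) = begin
    weightedSum nonemptySign (x ∷ xs)
  ≡⟨ weightedSum-∷ nonemptySign x xs ⟩
    x * weightedSum sign xs + weightedSum nonemptySign xs
  ≡⟨ cong₂ (λ a b → x * a + b) (inclusionExclusion xs) (inclusionExclusion⁺ xs) ⟩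
    x * complementProduct xs + (1ℚ - complementProduct xs)
  ≡⟨ solve 2 (λ x c → x :* c :+ (con 1ℚ :- c) := con 1ℚ :- (con 1ℚ :- x) :* c) refl x _ ⟩
    1ℚ - complementProduct (x ∷ xs)
  ∎

sum-nonemptySubsets : ∀ {m} (f : Subset m → ℚ) →
  sumℚ (map (λ J → sign (∣ J ∣ ∸ 1) * f J) (nonemptySubsets m))
    ≡ sumℚ (map (λ J → nonemptySign ∣ J ∣ * f J) (allSubsets m))
sum-nonemptySubsets {m} f =
  trans (sumℚ-filter _ (λ J → sign (∣ J ∣ ∸ 1) * f J) (allSubsets m))
        (cong sumℚ (ListP.map-cong (λ J → indicator ∣ J ∣ (f J)) (allSubsets m)))
  where
  indicator : ∀ j c →
    (if (if j ℕ.≡ᵇ 0 then false else true) then sign (j ∸ 1) * c else 0ℚ) ≡ nonemptySign j * c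
  indicator zero    c = sym (ℚP.*-zeroˡ c)
  indicator (suc j) c = refl

pow-+ : ∀ q a b → q ^ (a ℕ.+ b) ≡ q ^ a * q ^ b
pow-+ q zero    b = sym (ℚP.*-identityˡ _)
pow-+ q (suc a) b = trans (cong (q *_) (pow-+ q a b)) (sym (ℚP.*-assoc q _ _))

qPoch-suc-⊘ : ∀ q n y → qPoch q (suc n) ⊘ y ≡ (1ℚ - q ^ suc n) * (qPoch q n ⊘ y)
qPoch-suc-⊘ q n y =
  trans (cong (_⊘ y) (ℚP.*-comm (qPoch q n) _)) (⊘-*-assoc (1ℚ - q ^ suc n) (qPoch q n) y)

qPochProduct : ℚ → ∀ {m} → Vec ℕ m → ℚ
qPochProduct q ks = Vec.foldr _ (λ k acc → qPoch q k * acc) 1ℚ ks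

qFactors : ℚ → ∀ {m} → Vec ℕ m → Vec ℚ m
qFactors q = Vec.map (λ k → 1ℚ - q ^ k)

complementProduct-qFactors : ∀ q {m} (ks : Vec ℕ m) →
  complementProduct (qFactors q ks) ≡ q ^ sum ks
complementProduct-qFactors q []       = refl
complementProduct-qFactors q (k ∷ ks) = begin
    (1ℚ - (1ℚ - q ^ k)) * complementProduct (qFactors q ks)
  ≡⟨ cong₂ _*_ (solve 1 (λ a → con 1ℚ :- (con 1ℚ :- a) := a) refl (q ^ k))
               (complementProduct-qFactors q ks) ⟩
    q ^ k * q ^ sum ks
  ≡⟨ sym (pow-+ q k (sum ks)) ⟩
    q ^ sum (k ∷ ks)
  ∎

-- Since (q)_k = (q)_{k-1} (1 - q^k) for k ≥ 1, lowering the entries in J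
-- by one removes exactly the factor x_J:  P = P_{k - e_J} · x_J.
qPochProduct-minusE : ∀ q {m} (ks : Vec ℕ m) (J : Subset m) → All (1 ≤_) ks →
  qPochProduct q ks ≡ qPochProduct q (minusE ks J) * monomial (qFactors q ks) J
qPochProduct-minusE q [] [] [] = refl
qPochProduct-minusE q (suc k ∷ ks) (true ∷ J) (s≤s z≤n ∷ ks≥1) = begin
    qPoch q k * x * P
  ≡⟨ cong (qPoch q k * x *_) (qPochProduct-minusE q ks J ks≥1) ⟩
    qPoch q k * x * (PJ * xJ)
  ≡⟨ solve 4 (λ a x p e → a :* x :* (p :* e) := a :* p :* (x :* e)) refl (qPoch q k) x PJ xJ ⟩
    qPoch q k * PJ * (x * xJ)
  ∎
  where
  x  = 1ℚ - q ^ suc k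
  P  = qPochProduct q ks
  PJ = qPochProduct q (minusE ks J)
  xJ = monomial (qFactors q ks) J
qPochProduct-minusE q (k ∷ ks) (false ∷ J) (_ ∷ ks≥1) =
  trans (cong (qPoch q k *_) (qPochProduct-minusE q ks J ks≥1))
        (sym (ℚP.*-assoc (qPoch q k) _ _))

entry-≤-sum : ∀ {m} (ks : Vec ℕ m) → All (_≤ sum ks) ks
entry-≤-sum []       = []
entry-≤-sum (k ∷ ks) =
  ℕP.m≤m+n k (sum ks) ∷ All.map (λ k≤ → ℕP.≤-trans k≤ (ℕP.m≤n+m (sum ks) k)) (entry-≤-sum ks)

module NonVanishing (q : ℚ) (N : ℕ) (1-qʲ≢0 : ∀ j → 1 ≤ j → j ≤ N → 1ℚ - q ^ j ≢ 0ℚ) where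

  qPoch-≢0 : ∀ j → j ≤ N → qPoch q j ≢ 0ℚ
  qPoch-≢0 zero    _   = λ ()
  qPoch-≢0 (suc j) j+1≤N =
    *-≢0 _ _ (qPoch-≢0 j (ℕP.≤-trans (ℕP.n≤1+n j) j+1≤N)) (1-qʲ≢0 (suc j) (s≤s z≤n) j+1≤N)

  qPochProduct-≢0 : ∀ {m} (ks : Vec ℕ m) → All (_≤ N) ks → qPochProduct q ks ≢ 0ℚ
  qPochProduct-≢0 []       []           = λ ()
  qPochProduct-≢0 (k ∷ ks) (k≤N ∷ ks≤N) = *-≢0 _ _ (qPoch-≢0 k k≤N) (qPochProduct-≢0 ks ks≤N)

module Summand (q : ℚ) (n : ℕ) (1-qʲ≢0 : ∀ j → 1 ≤ j → j ≤ suc n → 1ℚ - q ^ j ≢ 0ℚ)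
               {m : ℕ} (k : Vec ℕ m) (k≥1 : All (1 ≤_) k) (P≢0 : qPochProduct q k ≢ 0ℚ) where
  open NonVanishing q (suc n) 1-qʲ≢0

  summand-collapse : ∀ J →
    sign (∣ J ∣ ∸ 1) * (qPoch q n ⊘ qPoch q (suc n ∸ ∣ J ∣))
      * qMultinomial q (suc n ∸ ∣ J ∣) (minusE k J)
    ≡ sign (∣ J ∣ ∸ 1) * (monomial (qFactors q k) J * (qPoch q n ⊘ qPochProduct q k))
  summand-collapse J = begin
      s * (qn ⊘ a) * (a ⊘ PJ)
    ≡⟨ ℚP.*-assoc s _ _ ⟩
      s * ((qn ⊘ a) * (a ⊘ PJ))
    ≡⟨ cong (s *_) (⊘-chain qn a PJ (qPoch-≢0 _ (ℕP.m∸n≤m (suc n) ∣ J ∣))) ⟩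
      s * (qn ⊘ PJ)
    ≡⟨ cong (s *_) (⊘-factor qn PJ xJ (λ PJxJ≡0 → P≢0 (trans P≡PJxJ PJxJ≡0))) ⟩
      s * (xJ * (qn ⊘ (PJ * xJ)))
    ≡⟨ cong (λ t → s * (xJ * (qn ⊘ t))) (sym P≡PJxJ) ⟩
      s * (xJ * (qn ⊘ qPochProduct q k))
    ∎
    where
    s  = sign (∣ J ∣ ∸ 1)
    qn = qPoch q n
    a  = qPoch q (suc n ∸ ∣ J ∣)
    PJ = qPochProduct q (minusE k J)
    xJ = monomial (qFactors q k) J
    P≡PJxJ = qPochProduct-minusE q k J k≥1

lemma3p3 : (q : ℚ) → q ≢ 1ℚ →
    (m n : ℕ) → 2 ≤ m →
    (∀ j → 1 ≤ j → j ≤ suc n → 1ℚ - q ^ j ≢ 0ℚ) →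
    (k : Vec ℕ m) → All (1 ≤_) k → sum k ≡ suc n →
    qMultinomial q (suc n) k
      ≡ sumℚ (map (λ J → sign (∣ J ∣ ∸ 1) * (qPoch q n ⊘ qPoch q (suc n ∸ ∣ J ∣))
                           * qMultinomial q (suc n ∸ ∣ J ∣) (minusE k J))
                  (nonemptySubsets m))
lemma3p3 q _ m n _ 1-qʲ≢0 k k≥1 Σk≡n+1 = begin
    qPoch q (suc n) ⊘ P
  ≡⟨ qPoch-suc-⊘ q n P ⟩
    (1ℚ - q ^ suc n) * C
  ≡⟨ cong (λ t → (1ℚ - q ^ t) * C) (sym Σk≡n+1) ⟩
    (1ℚ - q ^ sum k) * C
  ≡⟨ cong (λ t → (1ℚ - t) * C) (sym (complementProduct-qFactors q k)) ⟩
    (1ℚ - complementProduct x) * C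
  ≡⟨ cong (_* C) (sym (inclusionExclusion⁺ x)) ⟩
    weightedSum nonemptySign x * C
  ≡⟨ sym (sumℚ-*ʳ C (λ J → nonemptySign ∣ J ∣ * monomial x J) (allSubsets m)) ⟩
    sumℚ (map (λ J → nonemptySign ∣ J ∣ * monomial x J * C) (allSubsets m))
  ≡⟨ cong sumℚ (ListP.map-cong (λ J → ℚP.*-assoc (nonemptySign ∣ J ∣) _ C) (allSubsets m)) ⟩
    sumℚ (map (λ J → nonemptySign ∣ J ∣ * (monomial x J * C)) (allSubsets m))
  ≡⟨ sym (sum-nonemptySubsets (λ J → monomial x J * C)) ⟩
    sumℚ (map (λ J → sign (∣ J ∣ ∸ 1) * (monomial x J * C)) (nonemptySubsets m))
  ≡⟨ sym (cong sumℚ (ListP.map-cong summand-collapse (nonemptySubsets m))) ⟩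
    _
  ∎
  where
  P = qPochProduct q k
  C = qPoch q n ⊘ P
  x = qFactors q k
  k≤n+1 = All.map (λ k≤Σ → ℕP.≤-trans k≤Σ (ℕP.≤-reflexive Σk≡n+1)) (entry-≤-sum k)
  open Summand q n 1-qʲ≢0 k k≥1 (NonVanishing.qPochProduct-≢0 q (suc n) 1-qʲ≢0 k k≤n+1)
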